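{- For $n\ge1$, the distribution of the major index on $\mathcal{R}_n^B$ is symmetric: for every $m$, the number of $\sigma\in\mathcal{R}_n^B$ with $\mathrm{maj}(\sigma)=m$ equals the number with $\mathrm{maj}(\sigma)=\binom{n}{2}-m$.
   Context: $[n]=\{1,\dots,n\}$, $\langle n\rangle=\{0,\pm1,\dots,\pm n\}$. A type $B$ set partition of $\langle n\rangle$ without zero block is encoded as $\pi=\pi_1\mid\cdots\mid\pi_k$: nonempty sets of nonzero integers with the sets $\{|a|:a\in\pi_i\}$ partitioning $[n]$, the element of smallest absolute value $m_i$ of $\pi_i$ positive, $m_1<\cdots<m_k$. It is merging-free if there is no $i\ge2$ with $\max_{a\in\pi_{i-1}}|a|<m_i$. $\mathrm{Flatten}(\pi)$ concatenates $\pi_1,\pi_2,\dots$, each written in increasing order of absolute value; $\mathcal{R}_n^B$ is the set of $\mathrm{Flatten}(\pi)$ over merging-free $\pi$. For $\sigma=\sigma_1\cdots\sigma_n$, $i\in[n-1]$ is a descent if $\sigma_i>\sigma_{i+1}$ (usual integer order), and $\mathrm{maj}(\sigma)$ is the sum of the descents. -}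

module Defs where

open import Data.Bool using (Bool; true; false; _∧_; not; if_then_else_)
open import Data.Nat as ℕ using (ℕ; zero; suc; _+_; _⊔_)
open import Data.Integer as ℤ using (ℤ; +_; -_; ∣_∣)
import Data.Integer.Properties as ℤP
open import Data.List using (List; []; _∷_; [_]; map; concat; concatMap; length; upTo; foldr)
open import Data.Bool.ListAction using (all; any)
open import Relation.Nullary.Decidable using (⌊_⌋)

range1 : ℕ → List ℕ
range1 n = map suc (upTo n)

letters : ℕ → List ℤ
letters n = concatMap (λ i → (+ i) ∷ (- (+ i)) ∷ []) (range1 n)

words : ℕ → ℕ → List (List ℤ)
words n zero    = [] ∷ []
words n (suc k) = concatMap (λ a → map (a ∷_) (words n k)) (letters n)

-- Major index (descents use the usual order of ℤ, positions 1-indexed)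

majFrom : ℕ → List ℤ → ℕ
majFrom i (x ∷ y ∷ r) = (if ⌊ y ℤP.<? x ⌋ then i else 0) + majFrom (suc i) (y ∷ r)
majFrom i _           = 0

maj : List ℤ → ℕ
maj σ = majFrom 1 σ

-- Type B set partitions of ⟨n⟩ without zero block.
-- π = π₁ ∣ ⋯ ∣ πₖ is represented as a list of blocks, each block being
-- written (as in Flatten) in increasing order of absolute value.

_<ᵇ_ : ℕ → ℕ → Bool
a <ᵇ b = ⌊ a ℕ.<? b ⌋

_==ᵇ_ : ℕ → ℕ → Bool
a ==ᵇ b = ⌊ a ℕ.≟ b ⌋

nonEmpty : List ℤ → Bool
nonEmpty []      = false
nonEmpty (_ ∷ _) = true

absIncreasing : List ℤ → Bool
absIncreasing (x ∷ y ∷ r) = (∣ x ∣ <ᵇ ∣ y ∣) ∧ absIncreasing (y ∷ r)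
absIncreasing _           = true

firstPositive : List ℤ → Bool
firstPositive []      = false
firstPositive (x ∷ _) = ⌊ ℤ.0ℤ ℤP.<? x ⌋

-- m_i = |first entry| of block i (0 for an empty block, which is excluded anyway)
minAbs : List ℤ → ℕ
minAbs []      = 0
minAbs (x ∷ _) = ∣ x ∣

maxAbs : List ℤ → ℕ
maxAbs b = foldr (λ x r → ∣ x ∣ ⊔ r) 0 b

minsIncreasing : List (List ℤ) → Bool
minsIncreasing (b ∷ c ∷ r) = (minAbs b <ᵇ minAbs c) ∧ minsIncreasing (c ∷ r)
minsIncreasing _           = true

elemℕ : ℕ → List ℕ → Bool
elemℕ i xs = any (λ j → i ==ᵇ j) xs

-- the sets {|a| : a ∈ πᵢ} partition [n]: the multiset of all absolute values
-- has n elements and contains every i ∈ [n]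
absPartition : ℕ → List (List ℤ) → Bool
absPartition n π =
  (length (concat π) ==ᵇ n) ∧ all (λ i → elemℕ i (map ∣_∣ (concat π))) (range1 n)

isTypeBPartition : ℕ → List (List ℤ) → Bool
isTypeBPartition n π =
  all nonEmpty π ∧ all absIncreasing π ∧ all firstPositive π
  ∧ minsIncreasing π ∧ absPartition n π

mergingFree : List (List ℤ) → Bool
mergingFree (b ∷ c ∷ r) = not (maxAbs b <ᵇ minAbs c) ∧ mergingFree (c ∷ r)
mergingFree _           = true

Flatten : List (List ℤ) → List ℤ
Flatten = concat

-- Membership in ℛₙᴮ.
-- splits σ lists every way of cutting σ into consecutive nonempty
-- segments, i.e. every list of nonempty blocks π with Flatten π = σ.

splits : List ℤ → List (List (List ℤ))
splits []       = [] ∷ []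
splits (x ∷ xs) = concatMap ext (splits xs)
  where
  ext : List (List ℤ) → List (List (List ℤ))
  ext []       = ((x ∷ []) ∷ []) ∷ []
  ext (b ∷ bs) = ((x ∷ b) ∷ bs) ∷ ((x ∷ []) ∷ b ∷ bs) ∷ []

inRB : ℕ → List ℤ → Bool
inRB n σ = any (λ π → isTypeBPartition n π ∧ mergingFree π) (splits σ)

countB : {A : Set} → (A → Bool) → List A → ℕ
countB p []       = 0
countB p (x ∷ xs) = (if p x then 1 else 0) + countB p xs

-- every element of ℛₙᴮ is a word of length n over ±[n], so
-- #{σ ∈ ℛₙᴮ : maj σ = m} is computed by scanning all such words
-- (which are listed without repetition).
countMaj : ℕ → ℕ → ℕ
countMaj n m = countB (λ σ → inRB n σ ∧ (maj σ ==ᵇ m)) (words n n)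

-- Let φ = negateAbsAscents keep the first letter of a signed word and negate every later letter
-- whose absolute value exceeds that of its predecessor. As φ preserves absolute values, it is an
-- involution on the words of length n over ±[n].
--
-- In the flattening of a merging-free partition the blocks increase in absolute value, every block
-- but the last has at least two letters (a singleton block would have maximum m_i < m_{i+1}), and
-- each block starts below the last letter of the previous one (merging-freeness, plus distinctness
-- of absolute values). So φ negates exactly the non-initial letters of the blocks, and its image is
-- again such a flattening. Moreover exactly one of σ and φ σ has a descent at each position: inside
-- a block the descent is decided by the sign of the right letter, at a seam by the sign of the left
-- one, and in both cases φ negates that letter. Hence maj σ + maj (φ σ) = 1 + ⋯ + (n - 1) = C(n,2),
-- and φ exchanges the fibres maj = m and maj = C(n,2) - m.

module Submission where

open import Defs
open import Data.Nat using (ℕ; _+_; _≤_)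
open import Data.Nat.Combinatorics using (_C_)
open import Relation.Binary.PropositionalEquality using (_≡_)

open import Data.Bool using (Bool; true; false; T; _∧_; not; if_then_else_)
open import Data.Bool.Properties using (T-∧)
open import Data.Bool.ListAction using (all; any; and)
open import Data.Empty using (⊥-elim)
open import Data.Integer as ℤ using (ℤ; -[1+_]; -_; ∣_∣; -<+; -<-; +<+)
open import Data.Integer.Properties as ℤP using (∣-i∣≡∣i∣)
open import Data.List using (List; []; _∷_; [_]; _++_; map; concat; length; upTo)
open import Data.List.Membership.Propositional using (_∈_; find; lose)
open import Data.List.Membership.Propositional.Properties
  using (∈-map⁺; ∈-map⁻; ∈-concatMap⁺; ∈-concatMap⁻; ∈-∃++; ∈-++⁺ʳ)
open import Data.List.Membership.Propositional.Properties.WithK using (unique∧set⇒bag)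
open import Data.List.Properties using (++-assoc; length-map; length-upTo; length-++-sucʳ; map-∘; map-cong; ∷-injective)
open import Data.List.Relation.Binary.BagAndSetEquality using (∼bag⇒↭)
open import Data.List.Relation.Binary.Permutation.Propositional using (_↭_)
open import Data.List.Relation.Binary.Permutation.Propositional.Properties as ↭ using (∈-resp-↭; shift)
open import Data.List.Relation.Binary.Pointwise as Pointwise using (Pointwise; []; _∷_; Pointwise-≡⇒≡)
open import Data.List.Relation.Binary.Subset.Propositional using (_⊆_)
open import Data.List.Relation.Unary.All as All using (All; []; _∷_)
open import Data.List.Relation.Unary.All.Properties as All using (all⁺)
open import Data.List.Relation.Unary.AllPairs as AllPairs using ([]; _∷_)
open import Data.List.Relation.Unary.AllPairs.Properties as AllPairs using ()
open import Data.List.Relation.Unary.Any as Any using (here; there)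
open import Data.List.Relation.Unary.Any.Properties using (any⁺; any⁻)
open import Data.List.Relation.Unary.Linked using (Linked; []; [-]; _∷_)
open import Data.List.Relation.Unary.Linked.Properties as Linked using ()
open import Data.List.Relation.Unary.Unique.Propositional using (Unique)
open import Data.List.Relation.Unary.Unique.Propositional.Properties as Unique using ()
open import Data.Nat as ℕ using (suc; zero; _*_; _⊔_; _<_)
open import Data.Nat.Combinatorics using (nC1≡n; nCk+nC[k+1]≡[n+1]C[k+1])
open import Data.Nat.ListAction using (sum)
open import Data.Nat.ListAction.Properties using (sum-↭)
open import Data.Nat.Properties as ℕP using (≤-trans; <⇒≤)
open import Data.Nat.Solver using (module +-*-Solver)
open import Data.Product using (∃; _×_; _,_; proj₁; proj₂)
open import Data.Unit using (tt)
open import Function using (_∘_; _on_; mk⇔; Equivalence)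
open import Relation.Nullary using (¬_; yes; no)
open import Relation.Nullary.Decidable using (⌊_⌋; toWitness; toWitnessFalse; fromWitness)
open import Relation.Binary.PropositionalEquality using (refl; sym; trans; cong; cong₂; subst; _≢_; module ≡-Reasoning)

open Equivalence using (to)

T-∧⁻ : ∀ x {y} → T (x ∧ y) → T x × T y
T-∧⁻ x = to (T-∧ {x})

T-ext : ∀ {x y} → (T x → T y) → (T y → T x) → x ≡ y
T-ext {false} {false} _   _   = refl
T-ext {false} {true}  _   y⇒x = ⊥-elim (y⇒x tt)
T-ext {true}  {false} x⇒y _   = ⊥-elim (x⇒y tt)
T-ext {true}  {true}  _   _   = refl

<ᵇ⇒< : ∀ {m n} → T (m <ᵇ n) → m < n
<ᵇ⇒< {m} {n} = toWitness {a? = m ℕ.<? n}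

-- The involution

negateIf : Bool → ℤ → ℤ
negateIf true  y = - y
negateIf false y = y

negateIfAbsAscent : ℤ → ℤ → ℤ
negateIfAbsAscent p y = negateIf (∣ p ∣ <ᵇ ∣ y ∣) y

negateAbsAscentsAfter : ℤ → List ℤ → List ℤ
negateAbsAscentsAfter p []      = []
negateAbsAscentsAfter p (y ∷ r) = negateIfAbsAscent p y ∷ negateAbsAscentsAfter y r

negateAbsAscents : List ℤ → List ℤ
negateAbsAscents []      = []
negateAbsAscents (x ∷ r) = x ∷ negateAbsAscentsAfter x r

∣negateIf∣ : ∀ b y → ∣ negateIf b y ∣ ≡ ∣ y ∣
∣negateIf∣ true  y = ∣-i∣≡∣i∣ y
∣negateIf∣ false y = refl

negateIf-involutive : ∀ b y → negateIf b (negateIf b y) ≡ y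
negateIf-involutive true  y = ℤP.neg-involutive y
negateIf-involutive false y = refl

negateIfAbsAscent-ascent : ∀ {a b} → ∣ a ∣ < ∣ b ∣ → negateIfAbsAscent a b ≡ - b
negateIfAbsAscent-ascent {a} {b} a<b with ∣ a ∣ ℕ.<? ∣ b ∣
... | yes _   = refl
... | no a≮b = ⊥-elim (a≮b a<b)

negateIfAbsAscent-descent : ∀ {a b} → ∣ b ∣ < ∣ a ∣ → negateIfAbsAscent a b ≡ b
negateIfAbsAscent-descent {a} {b} b<a with ∣ a ∣ ℕ.<? ∣ b ∣
... | yes a<b = ⊥-elim (ℕP.<-asym a<b b<a)
... | no _    = refl

negateAbsAscentsAfter-involutive : ∀ {p q} r → ∣ q ∣ ≡ ∣ p ∣ →
  negateAbsAscentsAfter q (negateAbsAscentsAfter p r) ≡ r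
negateAbsAscentsAfter-involutive         []      _   = refl
negateAbsAscentsAfter-involutive {p} {q} (y ∷ r) q≈p =
  cong₂ _∷_ y-restored (negateAbsAscentsAfter-involutive r (∣negateIf∣ b y))
  where
  b = ∣ p ∣ <ᵇ ∣ y ∣
  y-restored : negateIfAbsAscent q (negateIf b y) ≡ y
  y-restored = trans (cong₂ (λ u v → negateIf (u <ᵇ v) (negateIf b y)) q≈p (∣negateIf∣ b y))
                     (negateIf-involutive b y)

negateAbsAscents-involutive : ∀ σ → negateAbsAscents (negateAbsAscents σ) ≡ σ
negateAbsAscents-involutive []      = refl
negateAbsAscents-involutive (x ∷ r) = cong (x ∷_) (negateAbsAscentsAfter-involutive r refl)

SameAbs : List ℤ → List ℤ → Set
SameAbs = Pointwise (λ a b → ∣ a ∣ ≡ ∣ b ∣)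

negateAbsAscentsAfter-sameAbs : ∀ p r → SameAbs r (negateAbsAscentsAfter p r)
negateAbsAscentsAfter-sameAbs p []      = []
negateAbsAscentsAfter-sameAbs p (y ∷ r) =
  sym (∣negateIf∣ (∣ p ∣ <ᵇ ∣ y ∣) y) ∷ negateAbsAscentsAfter-sameAbs y r

negateAbsAscents-sameAbs : ∀ σ → SameAbs σ (negateAbsAscents σ)
negateAbsAscents-sameAbs []      = []
negateAbsAscents-sameAbs (x ∷ r) = refl ∷ negateAbsAscentsAfter-sameAbs x r

-- Words over ±[n]

range1-unique : ∀ n → Unique (range1 n)
range1-unique n = Unique.map⁺ ℕP.suc-injective (Unique.upTo⁺ n)

signed : ℕ → List ℤ
signed i = ℤ.+ i ∷ - ℤ.+ i ∷ []

∈-signed⇒∣∣≡ : ∀ {i y} → y ∈ signed i → ∣ y ∣ ≡ i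
∈-signed⇒∣∣≡     (here refl)         = refl
∈-signed⇒∣∣≡ {i} (there (here refl)) = ∣-i∣≡∣i∣ (ℤ.+ i)

∣∣≡⇒∈-signed : ∀ {i} y → ∣ y ∣ ≡ i → y ∈ signed i
∣∣≡⇒∈-signed (ℤ.+ j)  refl = here refl
∣∣≡⇒∈-signed -[1+ j ] refl = there (here refl)

letters-sameAbs : ∀ {n x y} → ∣ x ∣ ≡ ∣ y ∣ → x ∈ letters n → y ∈ letters n
letters-sameAbs {n} {y = y} x≈y x∈ = ∈-concatMap⁺ signed
  (Any.map (λ x∈i → ∣∣≡⇒∈-signed y (trans (sym x≈y) (∈-signed⇒∣∣≡ x∈i)))
           (∈-concatMap⁻ signed {xs = range1 n} x∈))

letters-unique : ∀ n → Unique (letters n)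
letters-unique n = Unique.concat⁺ {xss = map signed (range1 n)}
  (All.map⁺ (All.map⁺ (All.universal signed-suc-unique (upTo n))))
  (AllPairs.map⁺ (AllPairs.map signed-disjoint (range1-unique n)))
  where
  signed-suc-unique : ∀ j → Unique (signed (suc j))
  signed-suc-unique j = ((λ ()) ∷ []) ∷ [] ∷ []
  signed-disjoint : ∀ {i j} → i ≢ j → ∀ {y} → ¬ (y ∈ signed i × y ∈ signed j)
  signed-disjoint i≢j (y∈i , y∈j) = i≢j (trans (sym (∈-signed⇒∣∣≡ y∈i)) (∈-signed⇒∣∣≡ y∈j))

∈-words-suc⁻ : ∀ n k {σ} → σ ∈ words n (suc k) →
  ∃ λ a → ∃ λ ρ → σ ≡ a ∷ ρ × a ∈ letters n × ρ ∈ words n k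
∈-words-suc⁻ n k σ∈
  with a , a∈ , σ∈a ← find (∈-concatMap⁻ (λ a → map (a ∷_) (words n k)) {xs = letters n} σ∈)
  with ρ , ρ∈ , refl ← ∈-map⁻ (a ∷_) σ∈a
  = a , ρ , refl , a∈ , ρ∈

length-words : ∀ {n} k {σ} → σ ∈ words n k → length σ ≡ k
length-words     zero    (here refl) = refl
length-words {n} (suc k) σ∈ with _ , _ , refl , _ , ρ∈ ← ∈-words-suc⁻ n k σ∈ =
  cong suc (length-words k ρ∈)

words-sameAbs : ∀ {n} k {σ τ} → SameAbs σ τ → σ ∈ words n k → τ ∈ words n k
words-sameAbs     zero    []      σ∈        = σ∈
words-sameAbs     zero    (_ ∷ _) (here ())
words-sameAbs {n} (suc k) σ≈τ     σ∈
  with a , _ , refl , a∈ , ρ∈ ← ∈-words-suc⁻ n k σ∈ | a≈b ∷ ρ≈ ← σ≈τ =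
  ∈-concatMap⁺ (λ a → map (a ∷_) (words n k))
    (lose (letters-sameAbs {n} a≈b a∈) (∈-map⁺ (_ ∷_) (words-sameAbs k ρ≈ ρ∈)))

words-unique : ∀ n k → Unique (words n k)
words-unique n zero    = [] ∷ []
words-unique n (suc k) = Unique.concat⁺ {xss = map extend (letters n)}
  (All.map⁺ (All.universal extend-unique (letters n)))
  (AllPairs.map⁺ (AllPairs.map extend-disjoint (letters-unique n)))
  where
  extend : ℤ → List (List ℤ)
  extend a = map (a ∷_) (words n k)
  extend-unique : ∀ a → Unique (extend a)
  extend-unique a = Unique.map⁺ (proj₂ ∘ ∷-injective) (words-unique n k)
  extend-disjoint : ∀ {a b} → a ≢ b → ∀ {σ} → ¬ (σ ∈ extend a × σ ∈ extend b)
  extend-disjoint a≢b (σ∈a , σ∈b) with ∈-map⁻ _ σ∈a | ∈-map⁻ _ σ∈b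
  ... | _ , _ , refl | _ , _ , a∷≡b∷ = a≢b (proj₁ (∷-injective a∷≡b∷))

module _ {A : Set} where

  indicator : (A → Bool) → A → ℕ
  indicator p x = if p x then 1 else 0

  countB≡sum : ∀ p (xs : List A) → countB p xs ≡ sum (map (indicator p) xs)
  countB≡sum p []       = refl
  countB≡sum p (x ∷ xs) = cong (indicator p x +_) (countB≡sum p xs)

  countB-↭ : ∀ p {xs ys : List A} → xs ↭ ys → countB p xs ≡ countB p ys
  countB-↭ p {xs} {ys} xs↭ys = begin
    countB p xs                ≡⟨ countB≡sum p xs ⟩
    sum (map (indicator p) xs) ≡⟨ sum-↭ (↭.map⁺ (indicator p) xs↭ys) ⟩
    sum (map (indicator p) ys) ≡⟨ countB≡sum p ys ⟨
    countB p ys                ∎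
    where open ≡-Reasoning

  countB-map : ∀ {B : Set} p (f : B → A) xs → countB p (map f xs) ≡ countB (p ∘ f) xs
  countB-map p f []       = refl
  countB-map p f (x ∷ xs) = cong (indicator p (f x) +_) (countB-map p f xs)

  countB-cong : ∀ {p q} (xs : List A) → (∀ {x} → x ∈ xs → p x ≡ q x) → countB p xs ≡ countB q xs
  countB-cong []       _   = refl
  countB-cong (x ∷ xs) p≗q = cong₂ _+_ (cong (λ b → if b then 1 else 0) (p≗q (here refl)))
                                      (countB-cong xs (p≗q ∘ there))

  countB-involution : ∀ p {f : A → A} {xs} → (∀ x → f (f x) ≡ x) → Unique xs →
    (∀ {x} → x ∈ xs → f x ∈ xs) → countB (p ∘ f) xs ≡ countB p xs
  countB-involution p {f} {xs} f-involutive xs-unique f-closed = begin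
    countB (p ∘ f) xs   ≡⟨ countB-map p f xs ⟨
    countB p (map f xs) ≡⟨ countB-↭ p (∼bag⇒↭ (unique∧set⇒bag fxs-unique xs-unique (mk⇔ ⊆xs ⊆fxs))) ⟩
    countB p xs         ∎
    where
    open ≡-Reasoning
    f-injective : ∀ {x y} → f x ≡ f y → x ≡ y
    f-injective {x} {y} fx≡fy = trans (sym (f-involutive x)) (trans (cong f fx≡fy) (f-involutive y))
    fxs-unique : Unique (map f xs)
    fxs-unique = Unique.map⁺ f-injective xs-unique
    ⊆xs : map f xs ⊆ xs
    ⊆xs x∈ with _ , y∈ , refl ← ∈-map⁻ f x∈ = f-closed y∈
    ⊆fxs : xs ⊆ map f xs
    ⊆fxs {x} x∈ = subst (_∈ map f xs) (f-involutive x) (∈-map⁺ f (f-closed x∈))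

-- Complementary descents

isDescent : ℤ → ℤ → Bool
isDescent a b = ⌊ b ℤP.<? a ⌋

data ComplementaryDescents : List ℤ → List ℤ → Set where
  []  : ComplementaryDescents [] []
  [-] : ∀ {a c} → ComplementaryDescents [ a ] [ c ]
  _∷_ : ∀ {a b c d r s} → isDescent c d ≡ not (isDescent a b) →
        ComplementaryDescents (b ∷ r) (d ∷ s) → ComplementaryDescents (a ∷ b ∷ r) (c ∷ d ∷ s)

[1+m]C2≡m+mC2 : ∀ m → suc m C 2 ≡ m + m C 2
[1+m]C2≡m+mC2 m = trans (sym (nCk+nC[k+1]≡[n+1]C[k+1] m 1)) (cong (_+ m C 2) (nC1≡n m))

exactly-one-descent : ∀ u {v} → v ≡ not u → ∀ i M N →
  ((if u then i else 0) + M) + ((if v then i else 0) + N) ≡ i + (M + N)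
exactly-one-descent true  refl i M N = ℕP.+-assoc i M N
exactly-one-descent false refl i M N = solve 3 (λ i M N → M :+ (i :+ N) := i :+ (M :+ N)) refl i M N
  where open +-*-Solver

majFrom-complementary : ∀ i {a c r s} → ComplementaryDescents (a ∷ r) (c ∷ s) →
  majFrom i (a ∷ r) + majFrom i (c ∷ s) ≡ length r * i + length r C 2
majFrom-complementary i [-] = refl
majFrom-complementary i {a} {c} {b ∷ r} {d ∷ s} (cd≡¬ab ∷ cds) = begin
  majFrom i (a ∷ b ∷ r) + majFrom i (c ∷ d ∷ s)
    ≡⟨ exactly-one-descent (isDescent a b) cd≡¬ab i (majFrom (suc i) (b ∷ r)) (majFrom (suc i) (d ∷ s)) ⟩
  i + (majFrom (suc i) (b ∷ r) + majFrom (suc i) (d ∷ s))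
    ≡⟨ cong (i +_) (majFrom-complementary (suc i) cds) ⟩
  i + (m * suc i + m C 2)
    ≡⟨ solve 3 (λ i m c → i :+ (m :* (con 1 :+ i) :+ c) := (con 1 :+ m) :* i :+ (m :+ c)) refl i m (m C 2) ⟩
  suc m * i + (m + m C 2)
    ≡⟨ cong (suc m * i +_) ([1+m]C2≡m+mC2 m) ⟨
  suc m * i + suc m C 2
    ∎
  where
  open ≡-Reasoning
  open +-*-Solver
  m = length r

maj-complementary : ∀ {σ τ} → ComplementaryDescents σ τ → maj σ + maj τ ≡ length σ C 2
maj-complementary [] = refl
maj-complementary {a ∷ r} {c ∷ s} cds = trans (majFrom-complementary 1 cds)
  (trans (cong (_+ length r C 2) (ℕP.*-identityʳ (length r))) (sym ([1+m]C2≡m+mC2 (length r))))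

∣i∣<1+m⇒-[1+m]<i<+[1+m] : ∀ {m} i → ∣ i ∣ < suc m → -[1+ m ] ℤ.< i × i ℤ.< ℤ.+ suc m
∣i∣<1+m⇒-[1+m]<i<+[1+m] (ℤ.+ j)  j<1+m   = -<+ , +<+ j<1+m
∣i∣<1+m⇒-[1+m]<i<+[1+m] -[1+ j ] 1+j<1+m = -<- (ℕP.≤-pred 1+j<1+m) , -<+

isDescent-true : ∀ {a b} → b ℤ.< a → isDescent a b ≡ true
isDescent-true {a} {b} b<a with b ℤP.<? a
... | yes _   = refl
... | no b≮a = ⊥-elim (b≮a b<a)

isDescent-false : ∀ {a b} → ¬ b ℤ.< a → isDescent a b ≡ false
isDescent-false {a} {b} b≮a with b ℤP.<? a
... | yes b<a = ⊥-elim (b≮a b<a)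
... | no _    = refl

-- If ∣ a ∣ < ∣ b ∣, whether b < a depends only on the sign of b.
isDescent-absAscent : ∀ {a b c} → ∣ a ∣ < ∣ b ∣ → ∣ c ∣ ≡ ∣ a ∣ →
  isDescent c (- b) ≡ not (isDescent a b)
isDescent-absAscent {a} {ℤ.+ suc k} {c} a<b c≈a
  with -k<c , _ ← ∣i∣<1+m⇒-[1+m]<i<+[1+m] c (subst (_< suc k) (sym c≈a) a<b)
  with _ , a<k ← ∣i∣<1+m⇒-[1+m]<i<+[1+m] a a<b
  = trans (isDescent-true -k<c) (cong not (sym (isDescent-false (ℤP.<-asym a<k))))
isDescent-absAscent {a} { -[1+ k ] } {c} a<b c≈a
  with _ , c<k ← ∣i∣<1+m⇒-[1+m]<i<+[1+m] c (subst (_< suc k) (sym c≈a) a<b)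
  with -k<a , _ ← ∣i∣<1+m⇒-[1+m]<i<+[1+m] a a<b
  = trans (isDescent-false (ℤP.<-asym c<k)) (cong not (sym (isDescent-true -k<a)))

isDescent-absDescent : ∀ {a b} → ∣ b ∣ < ∣ a ∣ → isDescent (- a) b ≡ not (isDescent a b)
isDescent-absDescent {ℤ.+ suc k} {b} b<a with -k<b , b<k ← ∣i∣<1+m⇒-[1+m]<i<+[1+m] b b<a
  = trans (isDescent-false (ℤP.<-asym -k<b)) (cong not (sym (isDescent-true b<k)))
isDescent-absDescent { -[1+ k ] } {b} b<a with -k<b , b<k ← ∣i∣<1+m⇒-[1+m]<i<+[1+m] b b<a
  = trans (isDescent-true b<k) (cong not (sym (isDescent-false (ℤP.<-asym -k<b))))

-- The flag records whether the step into a was an absolute ascent (so that φ negates a);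
-- an absolute descent is allowed only right after one.
data AscentGuarded : Bool → ℤ → List ℤ → Set where
  []      : ∀ {f a} → AscentGuarded f a []
  ascent  : ∀ {f a b r} → ∣ a ∣ < ∣ b ∣ → AscentGuarded true b r → AscentGuarded f a (b ∷ r)
  descent : ∀ {a b r} → ∣ b ∣ < ∣ a ∣ → AscentGuarded false b r → AscentGuarded true a (b ∷ r)

complementaryDescents-negateAbsAscentsAfter : ∀ {f a r} → AscentGuarded f a r →
  ComplementaryDescents (a ∷ r) (negateIf f a ∷ negateAbsAscentsAfter a r)
complementaryDescents-negateAbsAscentsAfter [] = [-]
complementaryDescents-negateAbsAscentsAfter {f} {a} (ascent {b = b} {r} a<b guarded) =
  subst (λ d → ComplementaryDescents (a ∷ b ∷ r) (negateIf f a ∷ d ∷ negateAbsAscentsAfter b r))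
    (sym (negateIfAbsAscent-ascent {a} a<b))
    (isDescent-absAscent a<b (∣negateIf∣ f a) ∷ complementaryDescents-negateAbsAscentsAfter guarded)
complementaryDescents-negateAbsAscentsAfter {a = a} (descent {b = b} {r} b<a guarded) =
  subst (λ d → ComplementaryDescents (a ∷ b ∷ r) (- a ∷ d ∷ negateAbsAscentsAfter b r))
    (sym (negateIfAbsAscent-descent {a} b<a))
    (isDescent-absDescent b<a ∷ complementaryDescents-negateAbsAscentsAfter guarded)

-- Separated blocks

lastOf : ℤ → List ℤ → ℤ
lastOf x []      = x
lastOf x (y ∷ r) = lastOf y r

negateTail : List ℤ → List ℤ
negateTail []      = []
negateTail (x ∷ r) = x ∷ map -_ r

AbsIncreasing : List ℤ → Set
AbsIncreasing = Linked (_<_ on ∣_∣)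

data SeparatedBlocks : List (List ℤ) → Set where
  []   : SeparatedBlocks []
  last : ∀ {x r} → AbsIncreasing (x ∷ r) → SeparatedBlocks [ x ∷ r ]
  join : ∀ {x z r y s π} → AbsIncreasing (x ∷ z ∷ r) → ∣ y ∣ < ∣ lastOf z r ∣ →
         SeparatedBlocks ((y ∷ s) ∷ π) → SeparatedBlocks ((x ∷ z ∷ r) ∷ (y ∷ s) ∷ π)

negateAbsAscentsAfter-absIncreasing : ∀ {x r} rest → AbsIncreasing (x ∷ r) →
  negateAbsAscentsAfter x (r ++ rest) ≡ map -_ r ++ negateAbsAscentsAfter (lastOf x r) rest
negateAbsAscentsAfter-absIncreasing     rest [-]         = refl
negateAbsAscentsAfter-absIncreasing {x} rest (x<z ∷ inc) =
  cong₂ _∷_ (negateIfAbsAscent-ascent {x} x<z) (negateAbsAscentsAfter-absIncreasing rest inc)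

negateAbsAscentsAfter-absDescent : ∀ {l y} t → ∣ y ∣ < ∣ l ∣ →
  negateAbsAscentsAfter l (y ∷ t) ≡ negateAbsAscents (y ∷ t)
negateAbsAscentsAfter-absDescent {l} t y<l = cong (_∷ _) (negateIfAbsAscent-descent {l} y<l)

negateAbsAscents-concat : ∀ {π} → SeparatedBlocks π →
  negateAbsAscents (concat π) ≡ concat (map negateTail π)
negateAbsAscents-concat []         = refl
negateAbsAscents-concat (last inc) = cong (_ ∷_) (negateAbsAscentsAfter-absIncreasing [] inc)
negateAbsAscents-concat {(x ∷ z ∷ r) ∷ (y ∷ s) ∷ π} (join inc y<l sep) = cong (x ∷_) (begin
  negateAbsAscentsAfter x (z ∷ r ++ rest)
    ≡⟨ negateAbsAscentsAfter-absIncreasing rest inc ⟩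
  map -_ (z ∷ r) ++ negateAbsAscentsAfter (lastOf z r) rest
    ≡⟨ cong (map -_ (z ∷ r) ++_) (negateAbsAscentsAfter-absDescent {lastOf z r} (s ++ concat π) y<l) ⟩
  map -_ (z ∷ r) ++ negateAbsAscents rest
    ≡⟨ cong (map -_ (z ∷ r) ++_) (negateAbsAscents-concat sep) ⟩
  map -_ (z ∷ r) ++ concat (map negateTail ((y ∷ s) ∷ π))
    ∎)
  where
  open ≡-Reasoning
  rest = concat ((y ∷ s) ∷ π)

ascentGuarded-block : ∀ {f x z r rest} → AbsIncreasing (x ∷ z ∷ r) →
  AscentGuarded true (lastOf z r) rest → AscentGuarded f x (z ∷ r ++ rest)
ascentGuarded-block (x<z ∷ [-])         guarded = ascent x<z guarded
ascentGuarded-block (x<z ∷ inc@(_ ∷ _)) guarded = ascent x<z (ascentGuarded-block inc guarded)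

ascentGuarded-separatedBlocks : ∀ {x r π} → SeparatedBlocks ((x ∷ r) ∷ π) →
  AscentGuarded false x (r ++ concat π)
ascentGuarded-separatedBlocks (last [-])         = []
ascentGuarded-separatedBlocks (last inc@(_ ∷ _)) = ascentGuarded-block inc []
ascentGuarded-separatedBlocks (join inc y<l sep) =
  ascentGuarded-block inc (descent y<l (ascentGuarded-separatedBlocks sep))

maj-negateAbsAscents-concat : ∀ {π} → SeparatedBlocks π →
  maj (concat π) + maj (negateAbsAscents (concat π)) ≡ length (concat π) C 2
maj-negateAbsAscents-concat {[]}          _   = refl
maj-negateAbsAscents-concat {(_ ∷ _) ∷ _} sep =
  maj-complementary (complementaryDescents-negateAbsAscentsAfter (ascentGuarded-separatedBlocks sep))

-- Merging-free partitions

isMergingFreePartition : ℕ → List (List ℤ) → Bool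
isMergingFreePartition n π = isTypeBPartition n π ∧ mergingFree π

absIncreasing⇒AbsIncreasing : ∀ {b} → T (absIncreasing b) → AbsIncreasing b
absIncreasing⇒AbsIncreasing {[]}        _   = []
absIncreasing⇒AbsIncreasing {x ∷ []}    _   = [-]
absIncreasing⇒AbsIncreasing {x ∷ y ∷ r} inc =
  let x<y , inc′ = T-∧⁻ (∣ x ∣ <ᵇ ∣ y ∣) inc in <ᵇ⇒< x<y ∷ absIncreasing⇒AbsIncreasing {y ∷ r} inc′

minsIncreasing⇒Linked : ∀ {π} → T (minsIncreasing π) → Linked (_<_ on minAbs) π
minsIncreasing⇒Linked {[]}        _  = []
minsIncreasing⇒Linked {_ ∷ []}    _  = [-]
minsIncreasing⇒Linked {b ∷ c ∷ π} mi =
  let b<c , mi′ = T-∧⁻ (minAbs b <ᵇ minAbs c) mi in <ᵇ⇒< b<c ∷ minsIncreasing⇒Linked {c ∷ π} mi′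

mergingFree⇒Linked : ∀ {π} → T (mergingFree π) → Linked (λ b c → minAbs c ≤ maxAbs b) π
mergingFree⇒Linked {[]}        _  = []
mergingFree⇒Linked {_ ∷ []}    _  = [-]
mergingFree⇒Linked {b ∷ c ∷ π} mf =
  let c≤b , mf′ = T-∧⁻ (not (maxAbs b <ᵇ minAbs c)) mf
  in ℕP.≮⇒≥ (toWitnessFalse c≤b) ∷ mergingFree⇒Linked {c ∷ π} mf′

maxAbs-absIncreasing : ∀ {x r} → AbsIncreasing (x ∷ r) → maxAbs (x ∷ r) ≡ ∣ lastOf x r ∣
maxAbs-absIncreasing {x} [-] = ℕP.⊔-identityʳ ∣ x ∣
maxAbs-absIncreasing {x} {z ∷ r} (x<z ∷ inc) = begin
  ∣ x ∣ ⊔ maxAbs (z ∷ r) ≡⟨ ℕP.m≤n⇒m⊔n≡n (≤-trans (<⇒≤ x<z) (ℕP.m≤m⊔n ∣ z ∣ (maxAbs r))) ⟩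
  maxAbs (z ∷ r)         ≡⟨ maxAbs-absIncreasing inc ⟩
  ∣ lastOf z r ∣         ∎
  where open ≡-Reasoning

unique⊆⇒length≤ : ∀ {A : Set} {xs ys : List A} → Unique xs → xs ⊆ ys → length xs ≤ length ys
unique⊆⇒length≤ [] _ = ℕ.z≤n
unique⊆⇒length≤ {xs = x ∷ xs} (x∉xs ∷ xs-unique) x∷xs⊆ys
  with us , vs , refl ← ∈-∃++ (x∷xs⊆ys (here refl)) =
  subst (suc (length xs) ≤_) (sym (length-++-sucʳ us x vs)) (ℕ.s≤s (unique⊆⇒length≤ xs-unique xs⊆))
  where
  xs⊆ : xs ⊆ us ++ vs
  xs⊆ y∈xs with ∈-resp-↭ (shift x us vs) (x∷xs⊆ys (there y∈xs))
  ... | here refl    = ⊥-elim (All.lookup x∉xs y∈xs refl)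
  ... | there y∈usvs = y∈usvs

-- A repeated adjacent letter could be dropped, leaving a shorter list that still contains S.
unique⊆∧length≡⇒adjacent-distinct : ∀ {A : Set} {S : List A} → Unique S → ∀ us L →
  S ⊆ us ++ L → length (us ++ L) ≡ length S → Linked _≢_ L
unique⊆∧length≡⇒adjacent-distinct _ _ []       _ _ = []
unique⊆∧length≡⇒adjacent-distinct _ _ (_ ∷ []) _ _ = [-]
unique⊆∧length≡⇒adjacent-distinct {S = S} S-unique us (a ∷ b ∷ L) S⊆ len =
  a≢b ∷ unique⊆∧length≡⇒adjacent-distinct S-unique (us ++ [ a ]) (b ∷ L)
          (subst (S ⊆_) (sym assoc) S⊆) (trans (cong length assoc) len)
  where
  assoc : (us ++ [ a ]) ++ b ∷ L ≡ us ++ a ∷ b ∷ L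
  assoc = ++-assoc us [ a ] (b ∷ L)
  a≢b : a ≢ b
  a≢b refl = ℕP.1+n≰n (subst (_≤ length (us ++ a ∷ L)) (trans (sym len) (length-++-sucʳ us a (a ∷ L)))
                              (unique⊆⇒length≤ S-unique S⊆us++a∷L))
    where
    S⊆us++a∷L : S ⊆ us ++ a ∷ L
    S⊆us++a∷L i∈S with ∈-resp-↭ (shift a us (a ∷ L)) (S⊆ i∈S)
    ... | here refl    = ∈-++⁺ʳ us (here refl)
    ... | there i∈rest = i∈rest

absPartition⇒adjacent-abs-distinct : ∀ n π → T (absPartition n π) → Linked (_≢_ on ∣_∣) (concat π)
absPartition⇒adjacent-abs-distinct n π part =
  Linked.map⁻ (unique⊆∧length≡⇒adjacent-distinct (range1-unique n) [] (map ∣_∣ σ) range1⊆ length≡)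
  where
  σ = concat π
  length-and-cover = T-∧⁻ (length σ ==ᵇ n) part
  range1⊆ : range1 n ⊆ map ∣_∣ σ
  range1⊆ i∈ = Any.map toWitness (any⁻ _ _ (All.lookup (all⁺ _ (range1 n) (proj₂ length-and-cover)) i∈))
  length≡ : length (map ∣_∣ σ) ≡ length (range1 n)
  length≡ = begin
    length (map ∣_∣ σ) ≡⟨ length-map ∣_∣ σ ⟩
    length σ           ≡⟨ toWitness (proj₁ length-and-cover) ⟩
    n                  ≡⟨ length-upTo n ⟨
    length (upTo n)    ≡⟨ length-map suc (upTo n) ⟨
    length (range1 n)  ∎
    where open ≡-Reasoning

linked-seam : ∀ {R : ℤ → ℤ → Set} x r {y t} → Linked R (x ∷ r ++ y ∷ t) → R (lastOf x r) y × Linked R (y ∷ t)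
linked-seam x []      (Rxy ∷ Rt) = Rxy , Rt
linked-seam x (z ∷ r) (_ ∷ Rt)   = linked-seam z r Rt

separatedBlocks⁺ : ∀ {π} → All (T ∘ nonEmpty) π → All AbsIncreasing π → Linked (_<_ on minAbs) π →
  Linked (λ b c → minAbs c ≤ maxAbs b) π → Linked (_≢_ on ∣_∣) (concat π) → SeparatedBlocks π
separatedBlocks⁺ {[]}            _            _          _ _ _ = []
separatedBlocks⁺ {[] ∷ _}        (() ∷ _)     _          _ _ _
separatedBlocks⁺ {_ ∷ [] ∷ _}    (_ ∷ () ∷ _) _          _ _ _
separatedBlocks⁺ {(_ ∷ _) ∷ []}  _            (inc ∷ []) _ _ _ = last inc
separatedBlocks⁺ {(x ∷ []) ∷ (y ∷ s) ∷ π} _ (inc ∷ _) (x<y ∷ _) (y≤max ∷ _) _ =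
  ⊥-elim (ℕP.<⇒≱ x<y (subst (∣ y ∣ ≤_) (maxAbs-absIncreasing inc) y≤max))
separatedBlocks⁺ {(x ∷ z ∷ r) ∷ (y ∷ s) ∷ π} (_ ∷ ne) (inc ∷ incs) (_ ∷ mi) (y≤max ∷ mf) adj =
  join inc y<l (separatedBlocks⁺ ne incs mi mf (proj₂ seam))
  where
  seam = linked-seam x (z ∷ r) adj
  y<l : ∣ y ∣ < ∣ lastOf z r ∣
  y<l = ℕP.≤∧≢⇒< (subst (∣ y ∣ ≤_) (maxAbs-absIncreasing inc) y≤max) (proj₁ seam ∘ sym)

mergingFreePartition⇒separatedBlocks : ∀ n π → T (isMergingFreePartition n π) → SeparatedBlocks π
mergingFreePartition⇒separatedBlocks n π mfp =
  let partition , merging-free = T-∧⁻ (isTypeBPartition n π) mfp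
      non-empty , rest₁        = T-∧⁻ (all nonEmpty π) partition
      increasing , rest₂       = T-∧⁻ (all absIncreasing π) rest₁
      _ , rest₃                = T-∧⁻ (all firstPositive π) rest₂
      mins , abs-partition     = T-∧⁻ (minsIncreasing π) rest₃
  in separatedBlocks⁺ (all⁺ _ π non-empty) (All.map absIncreasing⇒AbsIncreasing (all⁺ _ π increasing))
       (minsIncreasing⇒Linked mins) (mergingFree⇒Linked merging-free)
       (absPartition⇒adjacent-abs-distinct n π abs-partition)

negate-sameAbs : ∀ r → SameAbs (map -_ r) r
negate-sameAbs []      = []
negate-sameAbs (y ∷ r) = ∣-i∣≡∣i∣ y ∷ negate-sameAbs r

negateTail-sameAbs : ∀ b → SameAbs (negateTail b) b
negateTail-sameAbs []      = []
negateTail-sameAbs (x ∷ r) = refl ∷ negate-sameAbs r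

concat-negateTail-sameAbs : ∀ π → SameAbs (concat (map negateTail π)) (concat π)
concat-negateTail-sameAbs []      = []
concat-negateTail-sameAbs (b ∷ π) = Pointwise.++⁺ (negateTail-sameAbs b) (concat-negateTail-sameAbs π)

absIncreasing-sameAbs : ∀ {xs ys} → SameAbs xs ys → absIncreasing xs ≡ absIncreasing ys
absIncreasing-sameAbs []               = refl
absIncreasing-sameAbs (_ ∷ [])         = refl
absIncreasing-sameAbs (x≈ ∷ y≈ ∷ rest) = cong₂ _∧_ (cong₂ _<ᵇ_ x≈ y≈) (absIncreasing-sameAbs (y≈ ∷ rest))

maxAbs-sameAbs : ∀ {xs ys} → SameAbs xs ys → maxAbs xs ≡ maxAbs ys
maxAbs-sameAbs []          = refl
maxAbs-sameAbs (x≈ ∷ rest) = cong₂ _⊔_ x≈ (maxAbs-sameAbs rest)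

map-abs-sameAbs : ∀ {xs ys} → SameAbs xs ys → map ∣_∣ xs ≡ map ∣_∣ ys
map-abs-sameAbs = Pointwise-≡⇒≡ ∘ Pointwise.map⁺ ∣_∣ ∣_∣

all-map-cong : ∀ {A : Set} (p q : A → Bool) (f : A → A) → (∀ b → p (f b) ≡ q b) →
  ∀ π → all p (map f π) ≡ all q π
all-map-cong p q f p∘f≗q π = cong and (trans (sym (map-∘ π)) (map-cong p∘f≗q π))

minAbs-negateTail : ∀ b → minAbs (negateTail b) ≡ minAbs b
minAbs-negateTail []      = refl
minAbs-negateTail (_ ∷ _) = refl

minsIncreasing-negateTail : ∀ π → minsIncreasing (map negateTail π) ≡ minsIncreasing π
minsIncreasing-negateTail []          = refl
minsIncreasing-negateTail (_ ∷ [])    = refl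
minsIncreasing-negateTail (b ∷ c ∷ π) =
  cong₂ _∧_ (cong₂ _<ᵇ_ (minAbs-negateTail b) (minAbs-negateTail c)) (minsIncreasing-negateTail (c ∷ π))

mergingFree-negateTail : ∀ π → mergingFree (map negateTail π) ≡ mergingFree π
mergingFree-negateTail []          = refl
mergingFree-negateTail (_ ∷ [])    = refl
mergingFree-negateTail (b ∷ c ∷ π) =
  cong₂ _∧_ (cong not (cong₂ _<ᵇ_ (maxAbs-sameAbs (negateTail-sameAbs b)) (minAbs-negateTail c)))
            (mergingFree-negateTail (c ∷ π))

absPartition-negateTail : ∀ n π → absPartition n (map negateTail π) ≡ absPartition n π
absPartition-negateTail n π =
  cong₂ _∧_ (cong (_==ᵇ n) (Pointwise.Pointwise-length same))
            (cong (λ L → all (λ i → elemℕ i L) (range1 n)) (map-abs-sameAbs same))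
  where
  same = concat-negateTail-sameAbs π

isMergingFreePartition-negateTail : ∀ n π →
  isMergingFreePartition n (map negateTail π) ≡ isMergingFreePartition n π
isMergingFreePartition-negateTail n π = cong₂ _∧_
  (cong₂ _∧_ (all-map-cong nonEmpty nonEmpty negateTail nonEmpty-negateTail π)
  (cong₂ _∧_ (all-map-cong absIncreasing absIncreasing negateTail (absIncreasing-sameAbs ∘ negateTail-sameAbs) π)
  (cong₂ _∧_ (all-map-cong firstPositive firstPositive negateTail firstPositive-negateTail π)
  (cong₂ _∧_ (minsIncreasing-negateTail π) (absPartition-negateTail n π)))))
  (mergingFree-negateTail π)
  where
  nonEmpty-negateTail : ∀ b → nonEmpty (negateTail b) ≡ nonEmpty b
  nonEmpty-negateTail []      = refl
  nonEmpty-negateTail (_ ∷ _) = refl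
  firstPositive-negateTail : ∀ b → firstPositive (negateTail b) ≡ firstPositive b
  firstPositive-negateTail []      = refl
  firstPositive-negateTail (_ ∷ _) = refl

-- Membership in ℛₙᴮ

splits-sound : ∀ σ {π} → π ∈ splits σ → concat π ≡ σ
splits-sound []       (here refl) = refl
splits-sound (x ∷ xs) π∈ with find (∈-concatMap⁻ _ {xs = splits xs} π∈)
... | []    , ρ∈ , here refl         = cong (x ∷_) (splits-sound xs ρ∈)
... | _ ∷ _ , ρ∈ , here refl         = cong (x ∷_) (splits-sound xs ρ∈)
... | _ ∷ _ , ρ∈ , there (here refl) = cong (x ∷_) (splits-sound xs ρ∈)

splits-cons : ∀ x r π → π ∈ splits (concat π) → ((x ∷ r) ∷ π) ∈ splits (x ∷ r ++ concat π)
splits-cons x []      []      _  = here refl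
splits-cons x []      (_ ∷ _) π∈ = ∈-concatMap⁺ _ (lose π∈ (there (here refl)))
splits-cons x (y ∷ r) π       π∈ = ∈-concatMap⁺ _ (lose (splits-cons y r π π∈) (here refl))

splits-complete : ∀ π → All (T ∘ nonEmpty) π → π ∈ splits (concat π)
splits-complete []            []       = here refl
splits-complete ((x ∷ r) ∷ π) (_ ∷ ne) = splits-cons x r π (splits-complete π ne)

inRB⇒partition : ∀ n σ → T (inRB n σ) → ∃ λ π → concat π ≡ σ × T (isMergingFreePartition n π)
inRB⇒partition n σ σ∈R with π , π∈ , mfp ← find (any⁻ (isMergingFreePartition n) (splits σ) σ∈R) =
  π , splits-sound σ π∈ , mfp

partition⇒inRB : ∀ n π → T (isMergingFreePartition n π) → T (inRB n (concat π))
partition⇒inRB n π mfp = any⁺ (isMergingFreePartition n) (lose (splits-complete π (all⁺ _ π non-empty)) mfp)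
  where
  non-empty = proj₁ (T-∧⁻ (all nonEmpty π) (proj₁ (T-∧⁻ (isTypeBPartition n π) mfp)))

inRB-negateAbsAscents⁺ : ∀ n σ → T (inRB n σ) → T (inRB n (negateAbsAscents σ))
inRB-negateAbsAscents⁺ n σ σ∈R with π , refl , mfp ← inRB⇒partition n σ σ∈R =
  subst (T ∘ inRB n) (sym (negateAbsAscents-concat (mergingFreePartition⇒separatedBlocks n π mfp)))
        (partition⇒inRB n (map negateTail π) (subst T (sym (isMergingFreePartition-negateTail n π)) mfp))

inRB-negateAbsAscents : ∀ n σ → inRB n (negateAbsAscents σ) ≡ inRB n σ
inRB-negateAbsAscents n σ = T-ext
  (λ φσ∈R → subst (T ∘ inRB n) (negateAbsAscents-involutive σ)
                  (inRB-negateAbsAscents⁺ n (negateAbsAscents σ) φσ∈R))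
  (inRB-negateAbsAscents⁺ n σ)

maj-negateAbsAscents : ∀ n σ → T (inRB n σ) → maj σ + maj (negateAbsAscents σ) ≡ length σ C 2
maj-negateAbsAscents n σ σ∈R with π , refl , mfp ← inRB⇒partition n σ σ∈R =
  maj-negateAbsAscents-concat (mergingFreePartition⇒separatedBlocks n π mfp)

==ᵇ-complement : ∀ {a b m k} → a + b ≡ m + k → (a ==ᵇ m) ≡ (b ==ᵇ k)
==ᵇ-complement {a} {b} {m} {k} a+b≡m+k = T-ext
  (λ a≡m → fromWitness (ℕP.+-cancelˡ-≡ a b k (trans a+b≡m+k (cong (_+ k) (sym (toWitness a≡m))))))
  (λ b≡k → fromWitness (ℕP.+-cancelʳ-≡ b a m (trans a+b≡m+k (cong (m +_) (sym (toWitness b≡k))))))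

inRBWithMaj : ℕ → ℕ → List ℤ → Bool
inRBWithMaj n m σ = inRB n σ ∧ (maj σ ==ᵇ m)

inRBWithMaj-negateAbsAscents : ∀ n {m k} σ → m + k ≡ length σ C 2 →
  inRBWithMaj n m σ ≡ inRBWithMaj n k (negateAbsAscents σ)
inRBWithMaj-negateAbsAscents n σ m+k≡ rewrite inRB-negateAbsAscents n σ with inRB n σ in σ∈R
... | false = refl
... | true  = ==ᵇ-complement (trans (maj-negateAbsAscents n σ (subst T (sym σ∈R) tt)) (sym m+k≡))

-- The argument works for every n.
mainTheorem13 : (n : ℕ) → 1 ≤ n → (m k : ℕ) → m + k ≡ n C 2 → countMaj n m ≡ countMaj n k
mainTheorem13 n _ m k m+k≡ = begin
  countB (inRBWithMaj n m) (words n n)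
    ≡⟨ countB-cong (words n n) (λ {σ} σ∈ → inRBWithMaj-negateAbsAscents n σ
         (trans m+k≡ (cong (_C 2) (sym (length-words n σ∈))))) ⟩
  countB (inRBWithMaj n k ∘ negateAbsAscents) (words n n)
    ≡⟨ countB-involution (inRBWithMaj n k) negateAbsAscents-involutive (words-unique n n)
         (λ {σ} → words-sameAbs n (negateAbsAscents-sameAbs σ)) ⟩
  countB (inRBWithMaj n k) (words n n)
    ∎
  where open ≡-Reasoning
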